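{- Let $S$ be a finite graded left regular band with associated lattice $L$ and support map $\operatorname{supp}:S\to L$, such that for every $X\in L$ the LRB $S_{\le X}$ satisfies the uniformity condition (U). Then $S$ (and hence every $S_{\le X}$) satisfies the commutativity condition $\sigma_i\sigma_j=\sigma_j\sigma_i$ for all $i,j$.
   Context: A left regular band (LRB) is a finite semigroup $S$ with identity satisfying $x^2=x$ and $xyx=xy$; equivalently there is a lattice $L$ and a surjection $\operatorname{supp}:S\to L$ with $\operatorname{supp}(xy)=\operatorname{supp}x\vee\operatorname{supp}y$ and $xy=x$ whenever $\operatorname{supp}y\le\operatorname{supp}x$. $S$ is partially ordered by $x\le y$ iff $xy=y$; graded means this poset is graded, with rank function $\mathrm{rk}$. Chambers are the elements of $S$ whose support is the maximum $\hat1$ of $L$. For $X\in L$, $S_{\le X}=\{y\in S:\operatorname{supp}y\le X\}$, an LRB with lattice $[\hat0,X]$ (same rank function); its chambers are the elements of support $X$. $\sigma_i$ denotes the sum of all elements of rank $i$ in the semigroup algebra over $\mathbb{Q}$ (of $S$ or of $S_{\le X}$, as appropriate). An LRB satisfies (U) if for all $i,j$ the coefficient of a chamber in $\sigma_i\sigma_j$ is the same for every chamber. -}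

module Defs where

open import Data.Nat using (ℕ; zero; suc)
import Data.Nat as ℕ
open import Data.Fin using (Fin; zero; suc)
import Data.Fin as F
open import Data.Rational using (ℚ; 0ℚ; 1ℚ; _+_; _*_)
open import Data.Product using (Σ; ∃; _×_; _,_)
open import Relation.Binary.PropositionalEquality using (_≡_; _≢_)
open import Relation.Nullary using (¬_; yes; no; Dec)

sumFin : (n : ℕ) → (Fin n → ℚ) → ℚ
sumFin zero    f = 0ℚ
sumFin (suc n) f = f zero + sumFin n (λ i → f (suc i))

⟦_⟧ : {P : Set} → Dec P → ℚ
⟦ yes _ ⟧ = 1ℚ
⟦ no  _ ⟧ = 0ℚ

-- L is a finite join-semilattice; its order is X ≤ Y iff X ∨ Y ≡ Y.
-- (A finite join-semilattice with bottom is a lattice; L has bottom supp ε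
-- because supp is a surjective monoid map onto (L,∨).)
record LRB (n m : ℕ) : Set where
  field
    _·_     : Fin n → Fin n → Fin n
    ε       : Fin n
    ·-assoc : ∀ x y z → (x · y) · z ≡ x · (y · z)
    ε-idˡ   : ∀ x → ε · x ≡ x
    ε-idʳ   : ∀ x → x · ε ≡ x
    idem    : ∀ x → x · x ≡ x
    lrb     : ∀ x y → (x · y) · x ≡ x · y
    _∨_     : Fin m → Fin m → Fin m
    ∨-assoc : ∀ X Y Z → (X ∨ Y) ∨ Z ≡ X ∨ (Y ∨ Z)
    ∨-comm  : ∀ X Y → X ∨ Y ≡ Y ∨ X
    ∨-idem  : ∀ X → X ∨ X ≡ X
    supp      : Fin n → Fin m
    supp-surj : ∀ X → ∃ λ x → supp x ≡ X
    supp-hom  : ∀ x y → supp (x · y) ≡ supp x ∨ supp y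
    supp-abs  : ∀ x y → supp y ∨ supp x ≡ supp x → x · y ≡ x

  _≤L_ : Fin m → Fin m → Set
  X ≤L Y = X ∨ Y ≡ Y

  _≤L?_ : ∀ X Y → Dec (X ≤L Y)
  X ≤L? Y = (X ∨ Y) F.≟ Y

  _≤S_ : Fin n → Fin n → Set
  x ≤S y = x · y ≡ y

  _<S_ : Fin n → Fin n → Set
  x <S y = x ≤S y × x ≢ y

  _⋖_ : Fin n → Fin n → Set
  x ⋖ y = x <S y × (∀ z → x <S z → ¬ (z <S y))

  IsRank : (Fin n → ℕ) → Set
  IsRank rk = (rk ε ≡ 0) × (∀ x y → x ⋖ y → rk y ≡ suc (rk x))

  -- Semigroup algebra ℚS: elements are functions S → ℚ (coefficients).
  _⊛_ : (Fin n → ℚ) → (Fin n → ℚ) → (Fin n → ℚ)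
  (f ⊛ g) z = sumFin n (λ x → sumFin n (λ y → ⟦ (x · y) F.≟ z ⟧ * (f x * g y)))

  -- σ_i of S_{≤X}, viewed in ℚS (S_{≤X} is a subsemigroup of S, so its
  -- algebra is the subalgebra of ℚS spanned by S_{≤X}).
  σ≤ : (Fin n → ℕ) → Fin m → ℕ → (Fin n → ℚ)
  σ≤ rk X i y = ⟦ supp y ≤L? X ⟧ * ⟦ rk y ℕ.≟ i ⟧

  σ : (Fin n → ℕ) → ℕ → (Fin n → ℚ)
  σ rk i y = ⟦ rk y ℕ.≟ i ⟧

  -- Condition (U) for S_{≤X}: chambers of S_{≤X} are elements of support X.
  U≤ : (Fin n → ℕ) → Fin m → Set
  U≤ rk X = ∀ i j c c' → supp c ≡ X → supp c' ≡ X →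
            (σ≤ rk X i ⊛ σ≤ rk X j) c ≡ (σ≤ rk X i ⊛ σ≤ rk X j) c'

  Comm : (Fin n → ℕ) → Set
  Comm rk = ∀ i j z → (σ rk i ⊛ σ rk j) z ≡ (σ rk j ⊛ σ rk i) z

  Comm≤ : (Fin n → ℕ) → Fin m → Set
  Comm≤ rk X = ∀ i j z → (σ≤ rk X i ⊛ σ≤ rk X j) z ≡ (σ≤ rk X j ⊛ σ≤ rk X i) z

-- The support map extends linearly to an algebra homomorphism from ℚS onto
-- the commutative algebra ℚL, so σᵢσⱼ and σⱼσᵢ put the same total mass on the
-- chambers of S≤X. Condition (U) for S≤X spreads this mass evenly over those
-- chambers, hence σᵢσⱼ and σⱼσᵢ have the same coefficient at every element of
-- support X. Since the indicator of S≤X is multiplicative, the coefficient of z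
-- in a product in ℚS is already computed in S≤(supp z), which gives Comm, and
-- multiplying by that indicator gives Comm≤.
module Submission where

open import Defs
open import Data.Nat using (ℕ)
open import Data.Fin using (Fin)
open import Data.Product using (_×_)

open import Algebra.Bundles using (CommutativeRing; CommutativeMonoid)
open import Data.Fin using (zero; suc; punchIn)
import Data.Fin as F
open import Data.Fin.Properties using (punchInᵢ≢i)
open import Data.Nat using (zero; suc)
open import Data.Product using (_,_; proj₁; proj₂)
open import Data.Rational using (ℚ; 0ℚ; 1ℚ; _+_; _*_; NonNegative; Positive)
open import Data.Rational.Properties
open import Data.Vec.Functional using (Vector; removeAt)
open import Function using (_∘_; _⇔_; mk⇔; Equivalence)
open import Relation.Binary.PropositionalEquality
open import Relation.Nullary using (¬_; yes; no; Dec; contradiction)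

open import Algebra.Properties.Semiring.Sum (CommutativeRing.semiring +-*-commutativeRing)
open import Algebra.Properties.CommutativeSemigroup
  (CommutativeMonoid.commutativeSemigroup *-1-commutativeMonoid)
  using (interchange; x∙yz≈y∙xz)

open ≡-Reasoning

⟦⟧-yes : {P : Set} (d : Dec P) → P → ⟦ d ⟧ ≡ 1ℚ
⟦⟧-yes (yes _) _ = refl
⟦⟧-yes (no ¬p) p = contradiction p ¬p

⟦⟧-no : {P : Set} (d : Dec P) → ¬ P → ⟦ d ⟧ ≡ 0ℚ
⟦⟧-no (yes p) ¬p = contradiction p ¬p
⟦⟧-no (no _) _ = refl

⟦⟧-nonNegative : {P : Set} (d : Dec P) → NonNegative ⟦ d ⟧
⟦⟧-nonNegative (yes _) = _
⟦⟧-nonNegative (no _) = _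

⟦⟧-*-cong : {P : Set} (d : Dec P) {a b : ℚ} → (P → a ≡ b) → ⟦ d ⟧ * a ≡ ⟦ d ⟧ * b
⟦⟧-*-cong (yes p) a≡b = cong (1ℚ *_) (a≡b p)
⟦⟧-*-cong (no _) {a} {b} _ = trans (*-zeroˡ a) (sym (*-zeroˡ b))

⟦⟧-× : {P Q R : Set} (r : Dec R) (p : Dec P) (q : Dec Q) →
       R ⇔ (P × Q) → ⟦ r ⟧ ≡ ⟦ p ⟧ * ⟦ q ⟧
⟦⟧-× r (yes p) (yes q) R⇔P×Q = ⟦⟧-yes r (Equivalence.from R⇔P×Q (p , q))
⟦⟧-× r (yes _) (no ¬q) R⇔P×Q = ⟦⟧-no r (¬q ∘ proj₂ ∘ Equivalence.to R⇔P×Q)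
⟦⟧-× r (no ¬p) q R⇔P×Q =
  trans (⟦⟧-no r (¬p ∘ proj₁ ∘ Equivalence.to R⇔P×Q)) (sym (*-zeroˡ ⟦ q ⟧))

*-cancelˡ-≡-pos : ∀ r .{{_ : Positive r}} {p q} → r * p ≡ r * q → p ≡ q
*-cancelˡ-≡-pos r eq =
  ≤-antisym (*-cancelˡ-≤-pos r (≤-reflexive eq)) (*-cancelˡ-≤-pos r (≤-reflexive (sym eq)))

sumFin≡sum : ∀ n (f : Vector ℚ n) → sumFin n f ≡ sum f
sumFin≡sum zero f = refl
sumFin≡sum (suc n) f = cong (f zero +_) (sumFin≡sum n (f ∘ suc))

∑-δ : ∀ {n} (a : Fin n) (h : Vector ℚ n) → ∑[ w < n ] (⟦ a F.≟ w ⟧ * h w) ≡ h a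
∑-δ {suc n} a h = begin
  sum t                                  ≡⟨ sum-remove t ⟩
  t a + sum (removeAt t a)               ≡⟨ cong₂ _+_ t-at-a (sum-cong-≗ t-off-a) ⟩
  h a + sum (λ (_ : Fin n) → 0ℚ)         ≡⟨ cong (h a +_) (sum-replicate-zero n) ⟩
  h a + 0ℚ                               ≡⟨ +-identityʳ (h a) ⟩
  h a                                    ∎
  where
  t : Vector ℚ (suc n)
  t w = ⟦ a F.≟ w ⟧ * h w

  t-at-a : t a ≡ h a
  t-at-a = trans (cong (_* h a) (⟦⟧-yes (a F.≟ a) refl)) (*-identityˡ (h a))

  t-off-a : ∀ i → t (punchIn a i) ≡ 0ℚ
  t-off-a i = trans
    (cong (_* h (punchIn a i)) (⟦⟧-no (a F.≟ punchIn a i) (punchInᵢ≢i a i ∘ sym)))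
    (*-zeroˡ (h (punchIn a i)))

∑-nonNegative : ∀ {n} (f : Vector ℚ n) → (∀ i → NonNegative (f i)) → NonNegative (sum f)
∑-nonNegative {zero} f _ = _
∑-nonNegative {suc n} f f≥0 =
  nonNeg+nonNeg⇒nonNeg (f zero) {{f≥0 zero}}
                       (sum (f ∘ suc)) {{∑-nonNegative (f ∘ suc) (f≥0 ∘ suc)}}

∑-positive : ∀ {n} (f : Vector ℚ n) → (∀ i → NonNegative (f i)) →
             ∀ i → Positive (f i) → Positive (sum f)
∑-positive {suc n} f f≥0 i fᵢ>0 = subst Positive (sym (sum-remove {i = i} f))
  (pos+nonNeg⇒pos (f i) {{fᵢ>0}} (sum (removeAt f i))
                  {{∑-nonNegative (removeAt f i) (f≥0 ∘ punchIn i)}})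

module _ {n m : ℕ} (S : LRB n m) where
  open LRB S

  supp-·-comm : ∀ x y → supp (x · y) ≡ supp (y · x)
  supp-·-comm x y = begin
    supp (x · y)      ≡⟨ supp-hom x y ⟩
    supp x ∨ supp y   ≡⟨ ∨-comm (supp x) (supp y) ⟩
    supp y ∨ supp x   ≡⟨ supp-hom y x ⟨
    supp (y · x)      ∎

  ∨-≤L⇒≤L : ∀ X Y Z → (X ∨ Y) ≤L Z → X ≤L Z
  ∨-≤L⇒≤L X Y Z X∨Y≤Z = begin
    X ∨ Z                ≡⟨ cong (X ∨_) X∨Y≤Z ⟨
    X ∨ ((X ∨ Y) ∨ Z)    ≡⟨ ∨-assoc X (X ∨ Y) Z ⟨
    (X ∨ (X ∨ Y)) ∨ Z    ≡⟨ cong (_∨ Z) (∨-assoc X X Y) ⟨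
    ((X ∨ X) ∨ Y) ∨ Z    ≡⟨ cong (λ W → (W ∨ Y) ∨ Z) (∨-idem X) ⟩
    (X ∨ Y) ∨ Z          ≡⟨ X∨Y≤Z ⟩
    Z                    ∎

  ∨-≤L⇔ : ∀ X Y Z → (X ∨ Y) ≤L Z ⇔ (X ≤L Z × Y ≤L Z)
  ∨-≤L⇔ X Y Z = mk⇔
    (λ X∨Y≤Z → ∨-≤L⇒≤L X Y Z X∨Y≤Z
             , ∨-≤L⇒≤L Y X Z (trans (cong (_∨ Z) (∨-comm Y X)) X∨Y≤Z))
    (λ (X≤Z , Y≤Z) → trans (∨-assoc X Y Z) (trans (cong (X ∨_) Y≤Z) X≤Z))

  Multiplicative : (Fin n → ℚ) → Set
  Multiplicative h = ∀ x y → h (x · y) ≡ h x * h y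

  below : Fin m → Fin n → ℚ
  below X w = ⟦ supp w ≤L? X ⟧

  below-multiplicative : ∀ X → Multiplicative (below X)
  below-multiplicative X x y =
    ⟦⟧-× (supp (x · y) ≤L? X) (supp x ≤L? X) (supp y ≤L? X)
         (subst (λ W → (W ≤L X) ⇔ (supp x ≤L X × supp y ≤L X)) (sym (supp-hom x y))
                (∨-≤L⇔ (supp x) (supp y) X))

  ⊛-as-∑ : ∀ f g z → (f ⊛ g) z ≡ ∑[ x < n ] ∑[ y < n ] (⟦ x · y F.≟ z ⟧ * (f x * g y))
  ⊛-as-∑ f g z = trans (sumFin≡sum n (λ x → sumFin n (term x)))
                       (sum-cong-≗ (λ x → sumFin≡sum n (term x)))
    where
    term : Fin n → Fin n → ℚ
    term x y = ⟦ x · y F.≟ z ⟧ * (f x * g y)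

  ⊛-restrict : ∀ h → Multiplicative h → ∀ f g z →
               ((λ w → h w * f w) ⊛ (λ w → h w * g w)) z ≡ h z * (f ⊛ g) z
  ⊛-restrict h h-mult f g z = begin
    ((λ w → h w * f w) ⊛ (λ w → h w * g w)) z
      ≡⟨ ⊛-as-∑ (λ w → h w * f w) (λ w → h w * g w) z ⟩
    ∑[ x < n ] ∑[ y < n ] (⟦ x · y F.≟ z ⟧ * ((h x * f x) * (h y * g y)))
      ≡⟨ sum-cong-≗ (λ x → sum-cong-≗ (term x)) ⟩
    ∑[ x < n ] ∑[ y < n ] (h z * (⟦ x · y F.≟ z ⟧ * (f x * g y)))
      ≡⟨ sum-cong-≗ (λ x → *-distribˡ-sum (h z) (λ y → ⟦ x · y F.≟ z ⟧ * (f x * g y))) ⟨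
    ∑[ x < n ] (h z * ∑[ y < n ] (⟦ x · y F.≟ z ⟧ * (f x * g y)))
      ≡⟨ *-distribˡ-sum (h z) (λ x → ∑[ y < n ] (⟦ x · y F.≟ z ⟧ * (f x * g y))) ⟨
    h z * ∑[ x < n ] ∑[ y < n ] (⟦ x · y F.≟ z ⟧ * (f x * g y))
      ≡⟨ cong (h z *_) (⊛-as-∑ f g z) ⟨
    h z * (f ⊛ g) z
      ∎
    where
    term : ∀ x y → ⟦ x · y F.≟ z ⟧ * ((h x * f x) * (h y * g y))
                 ≡ h z * (⟦ x · y F.≟ z ⟧ * (f x * g y))
    term x y = begin
      ⟦ x · y F.≟ z ⟧ * ((h x * f x) * (h y * g y))
        ≡⟨ cong (⟦ x · y F.≟ z ⟧ *_) (interchange (h x) (f x) (h y) (g y)) ⟩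
      ⟦ x · y F.≟ z ⟧ * ((h x * h y) * (f x * g y))
        ≡⟨ cong (λ c → ⟦ x · y F.≟ z ⟧ * (c * (f x * g y))) (h-mult x y) ⟨
      ⟦ x · y F.≟ z ⟧ * (h (x · y) * (f x * g y))
        ≡⟨ ⟦⟧-*-cong (x · y F.≟ z) (λ xy≡z → cong (λ w → h w * (f x * g y)) xy≡z) ⟩
      ⟦ x · y F.≟ z ⟧ * (h z * (f x * g y))
        ≡⟨ x∙yz≈y∙xz ⟦ x · y F.≟ z ⟧ (h z) (f x * g y) ⟩
      h z * (⟦ x · y F.≟ z ⟧ * (f x * g y))
        ∎

  weigh : (Fin n → ℚ) → (Fin n → ℚ) → ℚ
  weigh h a = ∑[ w < n ] (h w * a w)

  weigh-⊛ : ∀ h f g → weigh h (f ⊛ g) ≡ ∑[ x < n ] ∑[ y < n ] (h (x · y) * (f x * g y))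
  weigh-⊛ h f g = begin
    ∑[ w < n ] (h w * (f ⊛ g) w)
      ≡⟨ sum-cong-≗ (λ w → cong (h w *_) (⊛-as-∑ f g w)) ⟩
    ∑[ w < n ] (h w * ∑[ x < n ] ∑[ y < n ] (⟦ x · y F.≟ w ⟧ * (f x * g y)))
      ≡⟨ sum-cong-≗ (λ w → trans
           (*-distribˡ-sum (h w) (λ x → ∑[ y < n ] (⟦ x · y F.≟ w ⟧ * (f x * g y))))
           (sum-cong-≗ (λ x → *-distribˡ-sum (h w) (λ y → ⟦ x · y F.≟ w ⟧ * (f x * g y))))) ⟩
    ∑[ w < n ] ∑[ x < n ] ∑[ y < n ] (h w * (⟦ x · y F.≟ w ⟧ * (f x * g y)))
      ≡⟨ ∑-comm (λ w x → ∑[ y < n ] (h w * (⟦ x · y F.≟ w ⟧ * (f x * g y)))) ⟩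
    ∑[ x < n ] ∑[ w < n ] ∑[ y < n ] (h w * (⟦ x · y F.≟ w ⟧ * (f x * g y)))
      ≡⟨ sum-cong-≗ (λ x → ∑-comm (λ w y → h w * (⟦ x · y F.≟ w ⟧ * (f x * g y)))) ⟩
    ∑[ x < n ] ∑[ y < n ] ∑[ w < n ] (h w * (⟦ x · y F.≟ w ⟧ * (f x * g y)))
      ≡⟨ sum-cong-≗ (λ x → sum-cong-≗ (λ y → collapse x y)) ⟩
    ∑[ x < n ] ∑[ y < n ] (h (x · y) * (f x * g y))
      ∎
    where
    collapse : ∀ x y → ∑[ w < n ] (h w * (⟦ x · y F.≟ w ⟧ * (f x * g y)))
                     ≡ h (x · y) * (f x * g y)
    collapse x y = trans (sum-cong-≗ (λ w → x∙yz≈y∙xz (h w) ⟦ x · y F.≟ w ⟧ (f x * g y)))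
                         (∑-δ (x · y) (λ w → h w * (f x * g y)))

  weigh-supp-⊛-comm : ∀ (ψ : Fin m → ℚ) f g →
                      weigh (ψ ∘ supp) (f ⊛ g) ≡ weigh (ψ ∘ supp) (g ⊛ f)
  weigh-supp-⊛-comm ψ f g = begin
    weigh (ψ ∘ supp) (f ⊛ g)
      ≡⟨ weigh-⊛ (ψ ∘ supp) f g ⟩
    ∑[ x < n ] ∑[ y < n ] (ψ (supp (x · y)) * (f x * g y))
      ≡⟨ ∑-comm (λ x y → ψ (supp (x · y)) * (f x * g y)) ⟩
    ∑[ y < n ] ∑[ x < n ] (ψ (supp (x · y)) * (f x * g y))
      ≡⟨ sum-cong-≗ (λ y → sum-cong-≗ (λ x →
           cong₂ _*_ (cong ψ (supp-·-comm x y)) (*-comm (f x) (g y)))) ⟩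
    ∑[ y < n ] ∑[ x < n ] (ψ (supp (y · x)) * (g y * f x))
      ≡⟨ weigh-⊛ (ψ ∘ supp) g f ⟨
    weigh (ψ ∘ supp) (g ⊛ f)
      ∎

  chamber : Fin m → Fin n → ℚ
  chamber X w = ⟦ supp w F.≟ X ⟧

  chamberCount : Fin m → ℚ
  chamberCount X = ∑[ w < n ] chamber X w

  UniformOnChambers : Fin m → (Fin n → ℚ) → Set
  UniformOnChambers X a = ∀ c c' → supp c ≡ X → supp c' ≡ X → a c ≡ a c'

  weigh-chamber-uniform : ∀ {X a} → UniformOnChambers X a →
                          ∀ {z} → supp z ≡ X → weigh (chamber X) a ≡ chamberCount X * a z
  weigh-chamber-uniform {X} {a} uniform {z} z∈X = begin
    ∑[ w < n ] (chamber X w * a w)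
      ≡⟨ sum-cong-≗ (λ w → ⟦⟧-*-cong (supp w F.≟ X) (λ w∈X → uniform w z w∈X z∈X)) ⟩
    ∑[ w < n ] (chamber X w * a z)
      ≡⟨ *-distribʳ-sum (a z) (chamber X) ⟨
    chamberCount X * a z
      ∎

  chamberCount-positive : ∀ {X z} → supp z ≡ X → Positive (chamberCount X)
  chamberCount-positive {X} {z} z∈X =
    ∑-positive (chamber X) (λ w → ⟦⟧-nonNegative (supp w F.≟ X))
               z (subst Positive (sym (⟦⟧-yes (supp z F.≟ X) z∈X)) _)

  ⊛-comm-on-chambers : ∀ {X} f g → UniformOnChambers X (f ⊛ g) → UniformOnChambers X (g ⊛ f) →
                       ∀ {z} → supp z ≡ X → (f ⊛ g) z ≡ (g ⊛ f) z
  ⊛-comm-on-chambers {X} f g fg-uniform gf-uniform {z} z∈X =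
    *-cancelˡ-≡-pos (chamberCount X) {{chamberCount-positive z∈X}} (begin
      chamberCount X * (f ⊛ g) z  ≡⟨ weigh-chamber-uniform fg-uniform z∈X ⟨
      weigh (chamber X) (f ⊛ g)   ≡⟨ weigh-supp-⊛-comm (λ Y → ⟦ Y F.≟ X ⟧) f g ⟩
      weigh (chamber X) (g ⊛ f)   ≡⟨ weigh-chamber-uniform gf-uniform z∈X ⟩
      chamberCount X * (g ⊛ f) z  ∎)

  σ≤⊛σ≤ : ∀ rk X i j z → (σ≤ rk X i ⊛ σ≤ rk X j) z ≡ below X z * (σ rk i ⊛ σ rk j) z
  σ≤⊛σ≤ rk X i j z = ⊛-restrict (below X) (below-multiplicative X) (σ rk i) (σ rk j) z

  σ⊛σ-at-support : ∀ rk i j z →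
                   (σ rk i ⊛ σ rk j) z ≡ (σ≤ rk (supp z) i ⊛ σ≤ rk (supp z) j) z
  σ⊛σ-at-support rk i j z = sym (begin
    (σ≤ rk (supp z) i ⊛ σ≤ rk (supp z) j) z    ≡⟨ σ≤⊛σ≤ rk (supp z) i j z ⟩
    below (supp z) z * (σ rk i ⊛ σ rk j) z     ≡⟨ cong (_* (σ rk i ⊛ σ rk j) z) z-below ⟩
    1ℚ * (σ rk i ⊛ σ rk j) z                   ≡⟨ *-identityˡ _ ⟩
    (σ rk i ⊛ σ rk j) z                        ∎)
    where
    z-below : below (supp z) z ≡ 1ℚ
    z-below = ⟦⟧-yes (supp z ≤L? supp z) (∨-idem (supp z))

proposition8p3 : (n m : ℕ) (S : LRB n m) (rk : Fin n → ℕ) →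
    LRB.IsRank S rk →
    (∀ X → LRB.U≤ S rk X) →
    LRB.Comm S rk × (∀ X → LRB.Comm≤ S rk X)
proposition8p3 n m S rk _ U = comm , comm≤
  where
  open LRB S

  comm : Comm rk
  comm i j z = begin
    (σ rk i ⊛ σ rk j) z          ≡⟨ σ⊛σ-at-support S rk i j z ⟩
    (σ≤ rk Z i ⊛ σ≤ rk Z j) z    ≡⟨ ⊛-comm-on-chambers S (σ≤ rk Z i) (σ≤ rk Z j)
                                                         (U Z i j) (U Z j i) refl ⟩
    (σ≤ rk Z j ⊛ σ≤ rk Z i) z    ≡⟨ σ⊛σ-at-support S rk j i z ⟨
    (σ rk j ⊛ σ rk i) z          ∎
    where
    Z : Fin m
    Z = supp z

  comm≤ : ∀ X → Comm≤ rk X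
  comm≤ X i j z = begin
    (σ≤ rk X i ⊛ σ≤ rk X j) z            ≡⟨ σ≤⊛σ≤ S rk X i j z ⟩
    below S X z * (σ rk i ⊛ σ rk j) z    ≡⟨ cong (below S X z *_) (comm i j z) ⟩
    below S X z * (σ rk j ⊛ σ rk i) z    ≡⟨ σ≤⊛σ≤ S rk X j i z ⟨
    (σ≤ rk X j ⊛ σ≤ rk X i) z            ∎
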